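{- Let $P=(Q,\Sigma,q_{in},\Delta)$ be a $1$-phase-bounded protocol and $q_f\in Q$. There exist a topology $\Gamma$, an initial configuration $C=(\Gamma,L)$, a configuration $D=(\Gamma,L')$ and a vertex $v$ of $\Gamma$ with $C\to^* D$ and $L'(v)=q_f$ if and only if there exist a star topology $\Gamma'$, an initial configuration $C'=(\Gamma',L'')$ and a configuration $D'=(\Gamma',L''')$ with $C'\to^* D'$ and $L'''(\epsilon)=q_f$.
   Context: A broadcast protocol is a tuple $P=(Q,\Sigma,q_{in},\Delta)$ with finite state set $Q$, finite alphabet $\Sigma$, initial state $q_{in}$, and $\Delta\subseteq Q\times(\{!!m: m\in\Sigma\}\cup\{?m : m\in\Sigma\}\cup\{\tau\})\times Q$ ($!!m$ broadcast, $?m$ reception, $\tau$ internal). $R(q)=\{m:\exists q',(q,?m,q')\in\Delta\}$. A topology is a finite undirected graph $\Gamma=(V,E)$ without self-loops; $N(v)$ is the neighbourhood of $v$. A configuration is $(\Gamma,L)$ with $L:V\to Q$; initial if all vertices are labelled $q_{in}$. $C=(\Gamma,L)\xrightarrow{v,\delta}C'=(\Gamma,L')$ for $\delta=(q,\alpha,q')$ if $L(v)=q$, $L'(v)=q'$ and either $\alpha=\tau$ and all other labels unchanged, or $\alpha=!!m$, every $u\in N(v)$ satisfies $(L(u),?m,L'(u))\in\Delta$ or ($m\notin R(L(u))$ and $L'(u)=L(u)$), and vertices outside $\{v\}\cup N(v)$ are unchanged; $\to^*$ is the reflexive transitive closure. A star topology is a tree topology of height at most one: its vertex set is $\{\epsilon\}\cup\{1,\dots,n\}$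 for some $n\ge 0$ (words of length at most $1$ over $\mathbb{N}$), with edges exactly between the root $\epsilon$ and each other vertex. $P$ is $1$-phase-bounded if $Q$ can be partitioned into $Q_0,Q_1^b,Q_1^r$ with $q_{in}\in Q_0$ such that every $(q,\alpha,q')\in\Delta$ satisfies one of: $\alpha=\tau$ and $q,q'$ in the same part; $q,q'\in Q_1^b$, $\alpha$ a broadcast; $q,q'\in Q_1^r$, $\alpha$ a reception; $q\in Q_0,q'\in Q_1^r$, $\alpha$ a reception; $q\in Q_0,q'\in Q_1^b$, $\alpha$ a broadcast; $q\in Q_1^b,q'\in Q_1^r$, $\alpha$ a reception. -}

module Defs where

open import Data.Nat using (ℕ; suc)
open import Data.Fin using (Fin; zero; suc)
open import Data.Bool using (Bool; true; false; T)
open import Data.Product using (Σ; ∃; ∃-syntax; _×_; _,_)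
open import Data.Sum using (_⊎_)
open import Relation.Nullary using (¬_)
open import Relation.Binary.PropositionalEquality using (_≡_; refl)
open import Relation.Binary.Construct.Closure.ReflexiveTransitive using (Star)

data Action (M : Set) : Set where
  bcast : M → Action M
  recv  : M → Action M
  tau   : Action M

record Protocol : Set₁ where
  field
    nQ  : ℕ
    nΣ  : ℕ
    qin : Fin nQ
    Δ   : Fin nQ → Action (Fin nΣ) → Fin nQ → Set

record Topology : Set where
  field
    n         : ℕ
    adj       : Fin n → Fin n → Bool
    symmetric : ∀ u v → adj u v ≡ adj v u
    loopless  : ∀ v → adj v v ≡ false

module _ (P : Protocol) where
  open Protocol P

  State : Set
  State = Fin nQ

  Receives : State → Fin nΣ → Set
  Receives q m = ∃[ q' ] Δ q (recv m) q'

  module _ (Γ : Topology) where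
    open Topology Γ

    Labelling : Set
    Labelling = Fin n → State

    Initial : Labelling → Set
    Initial L = ∀ v → L v ≡ qin

    data Step (L L' : Labelling) : Set where
      stepTau : (v : Fin n) → Δ (L v) tau (L' v) →
                (∀ u → ¬ (u ≡ v) → L' u ≡ L u) → Step L L'
      stepBcast : (v : Fin n) (m : Fin nΣ) → Δ (L v) (bcast m) (L' v) →
                  (∀ u → T (adj v u) →
                     Δ (L u) (recv m) (L' u) ⊎ (¬ Receives (L u) m × L' u ≡ L u)) →
                  (∀ u → ¬ (u ≡ v) → ¬ T (adj v u) → L' u ≡ L u) →
                  Step L L'

    Reach : Labelling → Labelling → Set
    Reach = Star Step

-- Star topology with k leaves: vertex zero is the root ε, vertices suc i are leaves.
starAdj : (k : ℕ) → Fin (suc k) → Fin (suc k) → Bool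
starAdj k zero    zero    = false
starAdj k zero    (suc _) = true
starAdj k (suc _) zero    = true
starAdj k (suc _) (suc _) = false

starSym : (k : ℕ) → ∀ u v → starAdj k u v ≡ starAdj k v u
starSym k zero    zero    = refl
starSym k zero    (suc _) = refl
starSym k (suc _) zero    = refl
starSym k (suc _) (suc _) = refl

starLoop : (k : ℕ) → ∀ v → starAdj k v v ≡ false
starLoop k zero    = refl
starLoop k (suc _) = refl

starTopology : ℕ → Topology
starTopology k = record
  { n = suc k ; adj = starAdj k ; symmetric = starSym k ; loopless = starLoop k }

root : (k : ℕ) → Fin (suc k)
root k = zero

-- 1-phase-boundedness: partition Q into Q0, Q1b, Q1r (as a map to Part)
data Part : Set where
  P0 P1b P1r : Part

data Allowed {M : Set} : Part → Action M → Part → Set where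
  tauSame   : ∀ {p} → Allowed p tau p
  bcast1b   : ∀ {m} → Allowed P1b (bcast m) P1b
  recv1r    : ∀ {m} → Allowed P1r (recv m) P1r
  recv0→1r  : ∀ {m} → Allowed P0 (recv m) P1r
  bcast0→1b : ∀ {m} → Allowed P0 (bcast m) P1b
  recv1b→1r : ∀ {m} → Allowed P1b (recv m) P1r

OnePhaseBounded : Protocol → Set
OnePhaseBounded P =
  Σ (Fin (Protocol.nQ P) → Part) λ part →
    part (Protocol.qin P) ≡ P0 ×
    (∀ q α q' → Protocol.Δ P q α q' → Allowed (part q) α (part q'))

module Submission where

-- Let v be the vertex that reaches q_f. Receptions lead into Q₁ʳ, which is closed and has no
-- broadcasts, so a vertex whose message v receives has itself received nothing before sending it.
-- Put v at the root of a star with one leaf per distinct such sender, and replay the run: the root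
-- copies v, a leaf copies its vertex, and steps of all other vertices are dropped since v ignores
-- them. A leaf loses track of its vertex only when that vertex receives, i.e. after its last message
-- to v, when v is in Q₁ʳ and merely listens.

open import Defs
open import Data.Nat using (ℕ)
open import Data.Fin using (Fin; zero; suc)
open import Data.Fin.Properties using (_≟_)
open import Data.Bool using (true; false; T)
open import Data.Unit using (tt)
open import Data.Empty using (⊥-elim)
open import Data.Maybe using (Maybe; just; nothing)
open import Data.Product using (Σ; ∃-syntax; _×_; _,_; proj₁)
open import Data.Sum using (_⊎_; inj₁; inj₂; [_,_]′; fromInj₁)
open import Data.List using (List; []; _∷_; _++_; fromMaybe; length; lookup; deduplicate)
open import Data.List.Relation.Unary.All as All using ()
open import Data.List.Relation.Unary.Any using (here; index; any?)
open import Data.List.Relation.Unary.Any.Properties using (lookup-index)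
open import Data.List.Relation.Unary.AllPairs using (_∷_)
open import Data.List.Relation.Unary.Unique.Propositional using (Unique)
open import Data.List.Relation.Unary.Unique.DecPropositional.Properties using (deduplicate-!)
open import Data.List.Membership.Propositional using (_∈_; _∉_)
open import Data.List.Membership.Propositional.Properties
  using (∈-lookup; ∈-++⁻; ∈-++⁺ˡ; ∈-++⁺ʳ; ∈-deduplicate⁺; ∈-deduplicate⁻)
open import Data.Vec.Functional using (Vector; tail; updateAt) renaming (_∷_ to _◂_)
open import Data.Vec.Functional.Properties using (updateAt-updates; updateAt-minimal)
open import Function using (id; const; _∘_)
open import Function.Bundles using (_⇔_; mk⇔)
open import Relation.Nullary using (¬_; yes; no)
open import Relation.Binary.PropositionalEquality
open import Relation.Binary.Construct.Closure.ReflexiveTransitive using (ε; _◅_; _◅◅_; return)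

lookup-injective : ∀ {A : Set} {xs : List A} → Unique xs →
                   ∀ i j → lookup xs i ≡ lookup xs j → i ≡ j
lookup-injective {xs = _ ∷ _} _ zero zero _ = refl
lookup-injective (x∉ ∷ _) zero (suc j) x≡xⱼ = ⊥-elim (All.lookup x∉ (∈-lookup j) x≡xⱼ)
lookup-injective (x∉ ∷ _) (suc i) zero xᵢ≡x = ⊥-elim (All.lookup x∉ (∈-lookup i) (sym xᵢ≡x))
lookup-injective (_ ∷ u) (suc i) (suc j) e = cong suc (lookup-injective u i j e)

∈-fromMaybe⁻ : ∀ {A : Set} {x : A} {mx : Maybe A} → x ∈ fromMaybe mx → mx ≡ just x
∈-fromMaybe⁻ {mx = just _} (here refl) = refl

module _ {Msg : Set} where

  reception-enters-P1r : ∀ {p p'} {m : Msg} → Allowed p (recv m) p' → p' ≡ P1r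
  reception-enters-P1r recv1r    = refl
  reception-enters-P1r recv0→1r  = refl
  reception-enters-P1r recv1b→1r = refl

  P1r-absorbing : ∀ {α : Action Msg} {p'} → Allowed P1r α p' → p' ≡ P1r
  P1r-absorbing tauSame = refl
  P1r-absorbing recv1r  = refl

  P1r-cannot-broadcast : ∀ {m : Msg} {p'} → ¬ Allowed P1r (bcast m) p'
  P1r-cannot-broadcast ()

module _ (P : Protocol) where
  open Protocol P

  Reacts : State P → Fin nΣ → State P → Set
  Reacts q m q' = Δ q (recv m) q' ⊎ (¬ Receives P q m × q' ≡ q)

  module _ {k : ℕ} {M : Labelling P (starTopology k)} {m : Fin nΣ} where

    bcast-from-root : ∀ {q} {ls : Vector (State P) k} → Δ (M zero) (bcast m) q →
                      (∀ i → Reacts (M (suc i)) m (ls i)) → Step P (starTopology k) M (q ◂ ls)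
    bcast-from-root d reacts =
      stepBcast zero m d (λ { zero (); (suc i) _ → reacts i })
                         (λ { zero 0≢0 _ → ⊥-elim (0≢0 refl)
                            ; (suc _) _ unadjacent → ⊥-elim (unadjacent tt) })

    bcast-from-leaf : ∀ {q q'} i → Δ (M (suc i)) (bcast m) q → Reacts (M zero) m q' →
                      Step P (starTopology k) M (q' ◂ updateAt (tail M) i (const q))
    bcast-from-leaf i d react =
      stepBcast (suc i) m (subst (Δ (M (suc i)) (bcast m)) (sym (updateAt-updates i (tail M))) d)
                (λ { zero _ → react; (suc _) () })
                (λ { zero _ unadjacent → ⊥-elim (unadjacent tt)
                   ; (suc j) j≢i _ → updateAt-minimal j i (tail M) (j≢i ∘ cong suc) })

  module Steps (Γ : Topology) where
    open Topology Γ

    tau-step : ∀ {L : Labelling P Γ} {q} w → Δ (L w) tau q → Step P Γ L (updateAt L w (const q))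
    tau-step {L} w d =
      stepTau w (subst (Δ (L w) tau) (sym (updateAt-updates w L)) d)
                (λ u u≢w → updateAt-minimal u w L u≢w)

    actor : ∀ {L L'} → Step P Γ L L' → Fin n
    actor (stepTau x _ _)         = x
    actor (stepBcast x _ _ _ _) = x

    actor-moves : ∀ {L L'} (s : Step P Γ L L') → ∃[ α ] Δ (L (actor s)) α (L' (actor s))
    actor-moves (stepTau _ d _)         = tau , d
    actor-moves (stepBcast _ m d _ _) = bcast m , d

    bystander-stays-or-receives : ∀ {L L'} (s : Step P Γ L L') w → w ≢ actor s →
                                  L' w ≡ L w ⊎ ∃[ m ] Δ (L w) (recv m) (L' w)
    bystander-stays-or-receives (stepTau _ _ fixed) w w≢x = inj₁ (fixed w w≢x)
    bystander-stays-or-receives (stepBcast x m _ react fixed) w w≢x with adj x w in e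
    ... | false = inj₁ (fixed w w≢x (subst T e))
    ... | true  = [ (λ d → inj₂ (m , d)) , (λ (_ , stays) → inj₁ stays) ]′ (react w (subst T (sym e) tt))

    module Listener (v : Fin n) where

      sender : ∀ {L L'} → Step P Γ L L' → Maybe (Fin n)
      sender (stepTau _ _ _) = nothing
      sender (stepBcast x _ _ react _) with adj x v | react v
      ... | false | _      = nothing
      ... | true  | reactᵥ = [ const (just x) , const nothing ]′ (reactᵥ tt)

      heard-sender : ∀ {L L' u} (s : Step P Γ L L') → sender s ≡ just u →
                     actor s ≡ u × T (adj u v) ×
                     ∃[ m ] Δ (L u) (bcast m) (L' u) × Δ (L v) (recv m) (L' v)
      heard-sender (stepBcast x m d react _) e with adj x v in a | react v
      heard-sender (stepBcast x m d react _) () | false | _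
      ... | true | reactᵥ with reactᵥ tt
      heard-sender (stepBcast x m d react _) refl | true | reactᵥ | inj₁ received =
        refl , subst T (sym a) tt , m , d , received

      unheard-step-fixes-listener : ∀ {L L'} (s : Step P Γ L L') → actor s ≢ v →
                                    (∀ u → sender s ≢ just u) → L' v ≡ L v
      unheard-step-fixes-listener (stepTau _ _ fixed) x≢v _ = fixed v (x≢v ∘ sym)
      unheard-step-fixes-listener (stepBcast x m d react fixed) x≢v unheard with adj x v in e | react v
      ... | false | _ = fixed v (x≢v ∘ sym) (subst T e)
      ... | true  | reactᵥ with reactᵥ tt
      ... | inj₁ _          = ⊥-elim (unheard x refl)
      ... | inj₂ (_ , stays) = stays

      senders : ∀ {L L'} → Reach P Γ L L' → List (Fin n)
      senders ε       = []
      senders (s ◅ r) = fromMaybe (sender s) ++ senders r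

      ∈-senders⁻ : ∀ {L L1 L' u} (s : Step P Γ L L1) (r : Reach P Γ L1 L') →
                   u ∈ senders (s ◅ r) → sender s ≡ just u ⊎ u ∈ senders r
      ∈-senders⁻ s r u∈ = [ inj₁ ∘ ∈-fromMaybe⁻ , inj₂ ]′ (∈-++⁻ (fromMaybe (sender s)) u∈)

      ∈-senders⁺ : ∀ {L L1 L' u} (s : Step P Γ L L1) (r : Reach P Γ L1 L') →
                   sender s ≡ just u → u ∈ senders (s ◅ r)
      ∈-senders⁺ s r e = ∈-++⁺ˡ (subst (λ mx → _ ∈ fromMaybe mx) (sym e) (here refl))

      senders-adjacent : ∀ {L L' u} (r : Reach P Γ L L') → u ∈ senders r → T (adj u v)
      senders-adjacent (s ◅ r) u∈ with ∈-senders⁻ s r u∈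
      ... | inj₁ e = let (_ , adjacent , _) = heard-sender s e in adjacent
      ... | inj₂ u∈r = senders-adjacent r u∈r

module Phased (P : Protocol) (part : State P → Part)
              (allowed : ∀ q α q' → Protocol.Δ P q α q' → Allowed (part q) α (part q'))
              (Γ : Topology) where
  open Protocol P
  open Topology Γ
  open Steps P Γ

  InQ1r : Labelling P Γ → Fin n → Set
  InQ1r L w = part (L w) ≡ P1r

  allowed-at : ∀ {q α q' p} → part q ≡ p → Δ q α q' → Allowed p α (part q')
  allowed-at refl d = allowed _ _ _ d

  broadcast-outside-Q1r : ∀ {q m q'} → Δ q (bcast m) q' → part q ≢ P1r
  broadcast-outside-Q1r d e = P1r-cannot-broadcast (allowed-at e d)

  reception-into-Q1r : ∀ {q m q'} → Δ q (recv m) q' → part q' ≡ P1r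
  reception-into-Q1r d = reception-enters-P1r (allowed _ _ _ d)

  Q1r-step : ∀ {L L'} → Step P Γ L L' → ∀ w → InQ1r L w → InQ1r L' w
  Q1r-step s w w∈Q1r with w ≟ actor s
  ... | yes refl = let (_ , d) = actor-moves s in
                   P1r-absorbing (allowed-at w∈Q1r d)
  ... | no w≢x with bystander-stays-or-receives s w w≢x
  ...   | inj₁ stays    = trans (cong part stays) w∈Q1r
  ...   | inj₂ (_ , d) = reception-into-Q1r d

  module Simulation (v : Fin n) (us : List (Fin n)) (us-unique : Unique us)
                    (us-adjacent : ∀ {u} → u ∈ us → T (adj u v)) where
    open Listener v

    k : ℕ
    k = length us

    leaf : Fin k → Fin n
    leaf = lookup us

    StarLabelling : Set
    StarLabelling = Labelling P (starTopology k)

    open Steps P (starTopology k) using () renaming (tau-step to tau-step★)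

    leaf≢listener : ∀ i → leaf i ≢ v
    leaf≢listener i e = subst T (trans (cong (λ w → adj w v) e) (loopless v)) (us-adjacent (∈-lookup i))

    other-leaf : ∀ {x} i₀ → leaf i₀ ≡ x → ∀ i → i ≢ i₀ → leaf i ≢ x
    other-leaf i₀ e₀ i i≢i₀ e = i≢i₀ (lookup-injective us-unique i i₀ (trans e (sym e₀)))

    LeafTracks : Labelling P Γ → StarLabelling → Fin k → Set
    LeafTracks L M i = M (suc i) ≡ L (leaf i) ⊎ (InQ1r L (leaf i) × InQ1r L v)

    record Tracks {L L'} (r : Reach P Γ L L') (M : StarLabelling) : Set where
      field
        root-synced : M zero ≡ L v
        leaves      : ∀ i → LeafTracks L M i
        pending     : ∀ i → leaf i ∈ senders r ⊎ InQ1r L v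

    Covered : ∀ {L L'} → Reach P Γ L L' → Set
    Covered r = ∀ {u} → u ∈ senders r → u ∈ us

    senders-outside-Q1r : ∀ {L L' u} (r : Reach P Γ L L') → u ∈ senders r → ¬ InQ1r L u
    senders-outside-Q1r (s ◅ r) u∈ u∈Q1r with ∈-senders⁻ s r u∈
    ... | inj₁ e   = let (_ , _ , _ , d , _) = heard-sender s e in broadcast-outside-Q1r d u∈Q1r
    ... | inj₂ u∈r = senders-outside-Q1r r u∈r (Q1r-step s _ u∈Q1r)

    pending-step : ∀ {L L1 L'} (s : Step P Γ L L1) (r : Reach P Γ L1 L') {w} →
                   w ∈ senders (s ◅ r) ⊎ InQ1r L v → w ∈ senders r ⊎ InQ1r L1 v
    pending-step s r (inj₂ v∈Q1r) = inj₂ (Q1r-step s v v∈Q1r)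
    pending-step s r (inj₁ w∈) with ∈-senders⁻ s r w∈
    ... | inj₁ e   = let (_ , _ , _ , _ , received) = heard-sender s e in
                     inj₂ (reception-into-Q1r received)
    ... | inj₂ w∈r = inj₁ w∈r

    -- A synced leaf falls behind only through a reception the star does not replay. Its vertex is then
    -- in Q₁ʳ and never broadcasts again, so it is no longer pending: v already received its last
    -- message and is in Q₁ʳ too.
    leaf-tracks-step : ∀ {L L1 L'} (s : Step P Γ L L1) (r : Reach P Γ L1 L') (M : StarLabelling) i →
                       leaf i ∈ senders (s ◅ r) ⊎ InQ1r L v →
                       (M (suc i) ≡ L (leaf i) → leaf i ≢ actor s) →
                       LeafTracks L M i → LeafTracks L1 M i
    leaf-tracks-step s r M i _ _ (inj₂ (w∈Q1r , v∈Q1r)) = inj₂ (Q1r-step s _ w∈Q1r , Q1r-step s v v∈Q1r)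
    leaf-tracks-step {L1 = L1} s r M i pend not-actor (inj₁ synced)
      with bystander-stays-or-receives s (leaf i) (not-actor synced)
    ... | inj₁ stays   = inj₁ (trans synced (sym stays))
    ... | inj₂ (_ , d) = inj₂ (w∈Q1r , [ (λ w∈r → ⊥-elim (senders-outside-Q1r r w∈r w∈Q1r)) , id ]′
                                         (pending-step s r pend))
      where
        w∈Q1r : InQ1r L1 (leaf i)
        w∈Q1r = reception-into-Q1r d

    LeafMove : ∀ {L L1} → Step P Γ L L1 → (ls ls₁ : Vector (State P) k) → Fin k → Set
    LeafMove {L} {L1} s ls ls₁ i =
      ls₁ i ≡ L1 (leaf i) ⊎ (ls₁ i ≡ ls i × (ls i ≡ L (leaf i) → leaf i ≢ actor s))

    tracks-step : ∀ {L L1 L'} (s : Step P Γ L L1) (r : Reach P Γ L1 L') {M M₁ : StarLabelling} →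
                  M₁ zero ≡ L1 v → (∀ i → LeafMove s (tail M) (tail M₁) i) →
                  Tracks (s ◅ r) M → Tracks r M₁
    tracks-step {L1 = L1} s r {M} {M₁} root₁ moves t = record
      { root-synced = root₁
      ; leaves      = λ i → leaf-after i (moves i)
      ; pending     = λ i → pending-step s r (Tracks.pending t i) }
      where
        leaf-after : ∀ i → LeafMove s (tail M) (tail M₁) i → LeafTracks L1 M₁ i
        leaf-after i (inj₁ synced) = inj₁ synced
        leaf-after i (inj₂ (kept , not-actor)) =
          [ inj₁ ∘ trans kept , inj₂ ]′
            (leaf-tracks-step s r M i (Tracks.pending t i) not-actor (Tracks.leaves t i))

    leaf-adjacent : ∀ i → T (adj (leaf i) v)
    leaf-adjacent i = us-adjacent (∈-lookup i)

    leaf-index : ∀ {x} → x ∈ us → ∃[ i ] leaf i ≡ x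
    leaf-index x∈us = index x∈us , sym (lookup-index x∈us)

    not-a-leaf : ∀ {x} → x ∉ us → ∀ i → leaf i ≢ x
    not-a-leaf x∉us i e = x∉us (subst (_∈ us) e (∈-lookup i))

    moved-leaf : ∀ {L L1} (s : Step P Γ L L1) {ls : Vector (State P) k} i₀ → leaf i₀ ≡ actor s →
                 ∀ i → LeafMove s ls (updateAt ls i₀ (const (L1 (actor s)))) i
    moved-leaf {L1 = L1} s {ls} i₀ e₀ i with i ≟ i₀
    ... | yes refl = inj₁ (trans (updateAt-updates i₀ ls) (cong L1 (sym e₀)))
    ... | no i≢i₀  = inj₂ (updateAt-minimal i i₀ ls i≢i₀ , λ _ → other-leaf i₀ e₀ i i≢i₀)

    unsynced-leaf : ∀ {L x} {ls : Vector (State P) k} i₀ → leaf i₀ ≡ x → ls i₀ ≢ L x →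
                    ∀ i → ls i ≡ L (leaf i) → leaf i ≢ x
    unsynced-leaf {L} i₀ e₀ unsynced i synced e with i ≟ i₀
    ... | yes refl = unsynced (trans synced (cong L e₀))
    ... | no i≢i₀  = other-leaf i₀ e₀ i i≢i₀ e

    Followed : ∀ {L L'} → Reach P Γ L L' → StarLabelling → Set
    Followed r M = Σ StarLabelling λ M₁ → Reach P (starTopology k) M M₁ × Tracks r M₁

    module _ {L L1 L'} (s : Step P Γ L L1) (r : Reach P Γ L1 L') {M : StarLabelling}
             (t : Tracks (s ◅ r) M) where
      open Tracks t

      stay : L1 v ≡ L v → (∀ i → M (suc i) ≡ L (leaf i) → leaf i ≢ actor s) → Followed r M
      stay fixed not-actor =
        M , ε , tracks-step s r (trans root-synced (sym fixed)) (λ i → inj₂ (refl , not-actor i)) t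

      listener-tau : actor s ≡ v → Δ (L v) tau (L1 v) → Followed r M
      listener-tau x≡v d =
        updateAt M zero (const (L1 v)) ,
        return (tau-step★ zero (subst (λ q → Δ q tau (L1 v)) (sym root-synced) d)) ,
        tracks-step s r refl (λ i → inj₂ (refl , λ _ e → leaf≢listener i (trans e x≡v))) t

      leaf-tau : ∀ i₀ → leaf i₀ ≡ actor s → M (suc i₀) ≡ L (actor s) →
                 Δ (L (actor s)) tau (L1 (actor s)) → L1 v ≡ L v → Followed r M
      leaf-tau i₀ e₀ synced d fixed =
        updateAt M (suc i₀) (const (L1 (actor s))) ,
        return (tau-step★ (suc i₀) (subst (λ q → Δ q tau (L1 (actor s))) (sym synced) d)) ,
        tracks-step s r (trans root-synced (sym fixed)) (moved-leaf s i₀ e₀) t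

      listener-broadcast : ∀ {m} → Δ (L v) (bcast m) (L1 v) →
                           (∀ i → Reacts P (L (leaf i)) m (L1 (leaf i))) → Followed r M
      listener-broadcast {m} d reacts =
        L1 v ◂ (L1 ∘ leaf) ,
        return (bcast-from-root P (subst (λ q → Δ q (bcast m) (L1 v)) (sym root-synced) d)
                                (λ i → subst (λ q → Reacts P q m (L1 (leaf i))) (sym (synced i)) (reacts i))) ,
        tracks-step s r refl (λ _ → inj₁ refl) t
        where
          synced : ∀ i → M (suc i) ≡ L (leaf i)
          synced i = fromInj₁ (λ (_ , v∈Q1r) → ⊥-elim (broadcast-outside-Q1r d v∈Q1r)) (leaves i)

      leaf-broadcast : ∀ {m} i₀ → leaf i₀ ≡ actor s → Δ (L (actor s)) (bcast m) (L1 (actor s)) →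
                       Reacts P (L v) m (L1 v) → Followed r M
      leaf-broadcast {m} i₀ e₀ d react =
        L1 v ◂ updateAt (tail M) i₀ (const (L1 (actor s))) ,
        return (bcast-from-leaf P i₀ (subst (λ q → Δ q (bcast m) (L1 (actor s))) (sym synced) d)
                                   (subst (λ q → Reacts P q m (L1 v)) (sym root-synced) react)) ,
        tracks-step s r refl (moved-leaf s i₀ e₀) t
        where
          broadcaster-outside-Q1r : ¬ InQ1r L (leaf i₀)
          broadcaster-outside-Q1r = broadcast-outside-Q1r d ∘ subst (InQ1r L) e₀
          synced : M (suc i₀) ≡ L (actor s)
          synced = trans (fromInj₁ (⊥-elim ∘ broadcaster-outside-Q1r ∘ proj₁) (leaves i₀)) (cong L e₀)

    simulate-step : ∀ {L L1 L'} (s : Step P Γ L L1) (r : Reach P Γ L1 L') {M : StarLabelling} →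
                    Covered (s ◅ r) → Tracks (s ◅ r) M → Followed r M
    simulate-step {L} s@(stepTau x d fixed) r {M} _ t with x ≟ v | any? (x ≟_) us
    ... | yes refl | _        = listener-tau s r t refl d
    ... | no x≢v   | no x∉us  = stay s r t (fixed v (x≢v ∘ sym)) (λ i _ → not-a-leaf x∉us i)
    ... | no x≢v   | yes x∈us with leaf-index x∈us
    ...   | i₀ , e₀ with M (suc i₀) ≟ L x
    ...     | yes synced  = leaf-tau s r t i₀ e₀ synced d (fixed v (x≢v ∘ sym))
    ...     | no unsynced = stay s r t (fixed v (x≢v ∘ sym)) (unsynced-leaf i₀ e₀ unsynced)
    simulate-step s@(stepBcast x m d react _) r cov t with x ≟ v | any? (x ≟_) us
    ... | yes refl | _        =
      listener-broadcast s r t d (λ i → react (leaf i) (subst T (symmetric (leaf i) v) (leaf-adjacent i)))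
    ... | no x≢v   | yes x∈us =
      let (i₀ , e₀) = leaf-index x∈us in
      leaf-broadcast s r t i₀ e₀ d (react v (subst (λ w → T (adj w v)) e₀ (leaf-adjacent i₀)))
    ... | no x≢v   | no x∉us  =
      stay s r t (unheard-step-fixes-listener s x≢v unheard) (λ i _ → not-a-leaf x∉us i)
      where
        unheard : ∀ u → sender s ≢ just u
        unheard u e = x∉us (subst (_∈ us) (sym (proj₁ (heard-sender s e))) (cov (∈-senders⁺ s r e)))

    simulate : ∀ {L L'} (r : Reach P Γ L L') {M : StarLabelling} → Covered r → Tracks r M →
               ∃[ M' ] Reach P (starTopology k) M M' × M' zero ≡ L' v
    simulate ε {M} _ t = M , ε , Tracks.root-synced t
    simulate (s ◅ r) cov t =
      let (M₁ , steps₁ , t₁) = simulate-step s r cov t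
          (M' , steps' , done) = simulate r (cov ∘ ∈-++⁺ʳ _) t₁
      in M' , steps₁ ◅◅ steps' , done

star-reaches : ∀ P (part : State P → Part) →
               (∀ q α q' → Protocol.Δ P q α q' → Allowed (part q) α (part q')) →
               ∀ Γ {L L' : Labelling P Γ} → Initial P Γ L → Reach P Γ L L' → ∀ v →
               Σ ℕ λ k → Σ (Labelling P (starTopology k)) λ M → Σ (Labelling P (starTopology k)) λ M' →
                 Initial P (starTopology k) M × Reach P (starTopology k) M M' × M' (root k) ≡ L' v
star-reaches P part allowed Γ initial run v =
  let (M' , steps , done) = simulate run (∈-deduplicate⁺ _≟_) start
  in k , const (Protocol.qin P) , M' , (λ _ → refl) , steps , done
  where
    open Phased P part allowed Γ
    open Steps.Listener P Γ v
    open Simulation v (deduplicate _≟_ (senders run)) (deduplicate-! _≟_ (senders run))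
                      (senders-adjacent run ∘ ∈-deduplicate⁻ _≟_ (senders run))
    start : Tracks run (const (Protocol.qin P))
    start = record
      { root-synced = sym (initial v)
      ; leaves      = λ i → inj₁ (sym (initial (leaf i)))
      ; pending     = λ i → inj₁ (∈-deduplicate⁻ _≟_ (senders run) (∈-lookup i)) }

mainTheorem8 : (P : Protocol) → OnePhaseBounded P → (qf : State P) →
    (Σ Topology λ Γ → Σ (Labelling P Γ) λ L → Σ (Labelling P Γ) λ L' →
       Σ (Fin (Topology.n Γ)) λ v →
         Initial P Γ L × Reach P Γ L L' × L' v ≡ qf)
    ⇔
    (Σ ℕ λ k → Σ (Labelling P (starTopology k)) λ L'' →
       Σ (Labelling P (starTopology k)) λ L''' →
         Initial P (starTopology k) L'' × Reach P (starTopology k) L'' L''' ×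
         L''' (root k) ≡ qf)
mainTheorem8 P (part , _ , allowed) qf = mk⇔
  (λ (Γ , L , L' , v , initial , run , reached) →
     let (k , M , M' , initialₛ , runₛ , reachedₛ) = star-reaches P part allowed Γ initial run v
     in k , M , M' , initialₛ , runₛ , trans reachedₛ reached)
  (λ (k , M , M' , initial , run , reached) → starTopology k , M , M' , root k , initial , run , reached)
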